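{- Let $(X,\le)$ be a WQO and $\mathbf u=x_1\cdots x_n\in X^*$ a non-empty sequence. Then $$\uparrow_{\mathrm{st}}\mathbf u=\uparrow_*\left\{y_1\cdots y_k\ \middle|\ \begin{array}{l}0<k\le n,\\ 0=\ell_0<\ell_1<\dots<\ell_k=n,\\ \forall j=1,\dots,k:\ y_j\in\min\Big(\bigcap_{\ell_{j-1}<\ell\le\ell_j}\uparrow_X x_\ell\Big)\end{array}\right\},$$ where $\min(A)$ denotes a finite basis of the upwards-closed subset $A$ of $X$ (a finite set $B\subseteq A$ with $A=\uparrow_X B$). Moreover $\uparrow_{\mathrm{st}}\epsilon=\uparrow_*\epsilon$.
   Context: A WQO $(X,\le)$ is a set with a reflexive transitive relation such that every infinite sequence $(x_k)_k$ has $i<j$ with $x_i\le x_j$; every upwards-closed subset of a WQO has a finite basis. $\uparrow_X x=\{y\in X\mid x\le y\}$. $X^*$ is the set of finite sequences over $X$ with empty sequence $\epsilon$. Higman's ordering: $x_1\cdots x_n\le_* y_1\cdots y_m$ iff there are indices $1\le p_1<\dots<p_n\le m$ with $x_i\le y_{p_i}$. The stuttering ordering: $x_1\cdots x_n\le_{\mathrm{st}}y_1\cdots y_m$ iff there are indices $1\le p_1\le\dots\le p_n\le m$ with $x_i\le y_{p_i}$ for all $i$. $\uparrow_*S$ and $\uparrow_{\mathrm{st}}S$ denote upward closures in $X^*$ under $\le_*$ and $\le_{\mathrm{st}}$ respectively. -}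

module Defs where

open import Level using (Level; _⊔_)
open import Data.Nat using (ℕ; zero; suc; _<_; _≤_)
open import Data.Fin using (Fin; toℕ)
import Data.Fin as F
open import Data.List using (List; []; length; lookup)
open import Data.List.Membership.Propositional using (_∈_)
open import Data.Product using (Σ; ∃; _×_; _,_)
open import Relation.Binary.Core using (Rel)
open import Relation.Binary.Definitions using (Reflexive; Transitive)
open import Relation.Binary.PropositionalEquality using (_≡_)
open import Function.Bundles using (_⇔_)

module _ {a r : Level} {X : Set a} (_≼_ : Rel X r) where

  IsWQO : Set (a ⊔ r)
  IsWQO = Reflexive _≼_ × Transitive _≼_
        × (∀ (f : ℕ → X) → ∃ λ i → ∃ λ j → i < j × f i ≼ f j)

  UpX : List X → X → Set (a ⊔ r)
  UpX B z = ∃ λ b → b ∈ B × b ≼ z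

  HigmanLe : List X → List X → Set r
  HigmanLe xs ys = Σ (Fin (length xs) → Fin (length ys)) λ p →
      (∀ i j → toℕ i < toℕ j → toℕ (p i) < toℕ (p j))
    × (∀ i → lookup xs i ≼ lookup ys (p i))

  StutterLe : List X → List X → Set r
  StutterLe xs ys = Σ (Fin (length xs) → Fin (length ys)) λ p →
      (∀ i j → toℕ i ≤ toℕ j → toℕ (p i) ≤ toℕ (p j))
    × (∀ i → lookup xs i ≼ lookup ys (p i))

  UpHigman : ∀ {s} → (List X → Set s) → List X → Set (a ⊔ r ⊔ s)
  UpHigman S w = ∃ λ v → S v × HigmanLe v w

  -- ⋂_{i < ℓ ≤ j} ↑_X x_ℓ  (1-based positions ℓ; list index ℓ-1, i.e. i ≤ idx < j)
  Inter : List X → ℕ → ℕ → X → Set r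
  Inter u i j z = ∀ (l : Fin (length u)) → i ≤ toℕ l → toℕ l < j → lookup u l ≼ z

  IsFiniteBasis : ∀ {s} → (X → Set s) → List X → Set (a ⊔ r ⊔ s)
  IsFiniteBasis A B = (∀ {b} → b ∈ B → A b) × (∀ z → A z ⇔ UpX B z)

  BasisChoice : List X → (ℕ → ℕ → List X) → Set (a ⊔ r)
  BasisChoice u B = ∀ i j → i < j → j ≤ length u → IsFiniteBasis (Inter u i j) (B i j)

  Gen : List X → (ℕ → ℕ → List X) → List X → Set a
  Gen u B ys =
    0 < length ys × length ys ≤ length u
    × Σ (Fin (suc (length ys)) → ℕ) λ ℓ →
        ℓ F.zero ≡ 0 × ℓ (F.fromℕ (length ys)) ≡ length u
      × (∀ i j → toℕ i < toℕ j → ℓ i < ℓ j)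
      × (∀ (j : Fin (length ys)) → lookup ys j ∈ B (ℓ (F.inject₁ j)) (ℓ (F.suc j)))

module Submission where

-- A stuttering embedding p : u → w is a weakly increasing index map, and
-- weakly increasing maps are exactly strictly increasing maps "with repetition".
--
-- (⊆) Cut the positions of u into the maximal runs on which p is constant
--     (a run decomposition, built by induction on n).  Run j is sent to one
--     position q_j of w, with q strictly increasing, and w[q_j] lies above
--     every letter of the run, i.e. in the intersection for that run; the
--     basis yields y_j ≼ w[q_j].  So y₁⋯y_k is a generator Higman-below w.
-- (⊇) Given a generator y₁⋯y_k (a partition ℓ of the positions of u) and a
--     Higman embedding q of it in w, send each position of u to q of its
--     block: this is weakly increasing, and x_ℓ ≼ y_j ≼ w[q_j].
-- The empty word is handled separately, and of the WQO axioms only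
-- transitivity is used.

open import Defs
open import Level using (Level)
open import Data.Nat using (ℕ; zero; suc; _<_; _≤_; z≤n; s≤s; _<?_)
open import Data.Nat.Properties
  using (≤-refl; ≤-trans; ≤-reflexive; <-trans; ≤-<-trans; <-≤-trans; <⇒≤;
         ≤-pred; n<1+n; n≮n; ≮⇒≥; ≰⇒>; _≤?_; m≤n⇒m<n∨m≡n)
open import Data.Fin using (Fin; toℕ; fromℕ; fromℕ<; inject₁)
import Data.Fin as F
open import Data.Fin.Properties using (toℕ-fromℕ; toℕ-inject₁; toℕ-fromℕ<; toℕ-injective; toℕ<n)
open import Data.List using (List; []; _∷_; length; lookup)
open import Data.List.Membership.Propositional using (_∈_)
open import Data.Product using (Σ; _×_; _,_; proj₁; proj₂)
open import Data.Sum using (inj₁; inj₂)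
open import Data.Empty using (⊥-elim)
open import Relation.Nullary using (yes; no)
open import Relation.Binary.Core using (Rel)
open import Relation.Binary.PropositionalEquality using (_≡_; refl; sym; trans; cong; subst; module ≡-Reasoning)
open import Function.Bundles using (_⇔_; mk⇔; Equivalence)

chain⇒≤ : (f : ℕ → ℕ) (K : ℕ) → (∀ j → suc j < K → f j < f (suc j)) →
          ∀ i j → i ≤ j → j < K → f i ≤ f j
chain⇒≤ f K step i zero z≤n j<K = ≤-refl
chain⇒≤ f K step i (suc j) i≤j+1 j+1<K with m≤n⇒m<n∨m≡n i≤j+1
... | inj₂ refl = ≤-refl
... | inj₁ (s≤s i≤j) =
  ≤-trans (chain⇒≤ f K step i j i≤j (<-trans (n<1+n j) j+1<K)) (<⇒≤ (step j j+1<K))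

chain⇒< : (f : ℕ → ℕ) (K : ℕ) → (∀ j → suc j < K → f j < f (suc j)) →
          ∀ i j → i < j → j < K → f i < f j
chain⇒< f K step i (suc j) (s≤s i≤j) j+1<K =
  ≤-<-trans (chain⇒≤ f K step i j i≤j (<-trans (n<1+n j) j+1<K)) (step j j+1<K)

strict⇒weak : ∀ {k} (f : Fin k → ℕ) → (∀ i j → toℕ i < toℕ j → f i < f j) →
              ∀ i j → toℕ i ≤ toℕ j → f i ≤ f j
strict⇒weak f strict i j i≤j with m≤n⇒m<n∨m≡n i≤j
... | inj₁ i<j = <⇒≤ (strict i j i<j)
... | inj₂ i≡j = ≤-reflexive (cong f (toℕ-injective i≡j))

tabulate< : ∀ {a} {X : Set a} (k : ℕ) → ((j : ℕ) → j < k → X) → List X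
tabulate< zero    f = []
tabulate< (suc k) f = f 0 (s≤s z≤n) ∷ tabulate< k (λ j j<k → f (suc j) (s≤s j<k))

length-tabulate< : ∀ {a} {X : Set a} k (f : (j : ℕ) → j < k → X) → length (tabulate< k f) ≡ k
length-tabulate< zero    f = refl
length-tabulate< (suc k) f = cong suc (length-tabulate< k _)

lookup-tabulate< : ∀ {a} {X : Set a} k (f : (j : ℕ) → j < k → X) (j : Fin (length (tabulate< k f))) →
                   Σ (toℕ j < k) λ j<k → lookup (tabulate< k f) j ≡ f (toℕ j) j<k
lookup-tabulate< (suc k) f F.zero    = s≤s z≤n , refl
lookup-tabulate< (suc k) f (F.suc j) =
  let (j<k , eq) = lookup-tabulate< k (λ j j<k → f (suc j) (s≤s j<k)) j in s≤s j<k , eq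

record RunDecomposition (m n : ℕ) (P : Fin n → ℕ) : Set where
  field
    runs           : ℕ
    boundary value : ℕ → ℕ
    boundary-start : boundary 0 ≡ 0
    boundary-end   : boundary runs ≡ n
    boundary-step  : ∀ j → j < runs → boundary j < boundary (suc j)
    value-step     : ∀ j → suc j < runs → value j < value (suc j)
    value-bound    : ∀ j → j < runs → value j < m
    constant       : ∀ (l : Fin n) j → j < runs →
                     boundary j ≤ toℕ l → toℕ l < boundary (suc j) → P l ≡ value j

  boundary-strict : ∀ i j → i < j → j ≤ runs → boundary i < boundary j
  boundary-strict i j i<j j≤runs =
    chain⇒< boundary (suc runs) (λ j j+1≤runs → boundary-step j (≤-pred j+1≤runs)) i j i<j (s≤s j≤runs)

  value-strict : ∀ i j → i < j → j < runs → value i < value j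
  value-strict = chain⇒< value runs value-step

  boundary≤length : ∀ j → j ≤ runs → boundary j ≤ n
  boundary≤length j j≤runs with m≤n⇒m<n∨m≡n j≤runs
  ... | inj₁ j<runs = ≤-trans (<⇒≤ (boundary-strict j runs j<runs ≤-refl)) (≤-reflexive boundary-end)
  ... | inj₂ refl   = ≤-reflexive boundary-end

  index≤boundary : ∀ j → j ≤ runs → j ≤ boundary j
  index≤boundary zero    _         = z≤n
  index≤boundary (suc j) j+1≤runs = <-≤-trans (s≤s (index≤boundary j (<⇒≤ j+1≤runs)))
                                              (boundary-step j j+1≤runs)

  runs≤length : runs ≤ n
  runs≤length = ≤-trans (index≤boundary runs ≤-refl) (≤-reflexive boundary-end)

  runs-positive : 0 < n → 0 < runs
  runs-positive 0<n with runs in runs≡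
  ... | suc _ = s≤s z≤n
  ... | zero  = ⊥-elim (n≮n 0 (subst (0 <_) n≡0 0<n))
    where
    open ≡-Reasoning
    n≡0 : n ≡ 0
    n≡0 = begin
      n              ≡⟨ sym boundary-end ⟩
      boundary runs  ≡⟨ cong boundary runs≡ ⟩
      boundary 0     ≡⟨ boundary-start ⟩
      0              ∎

module RunConstruction where

  open RunDecomposition

  value-first : ∀ {m n} {P : Fin (suc n) → ℕ} (R : RunDecomposition m (suc n) P) → P F.zero ≡ value R 0
  value-first R = constant R F.zero 0 (runs-positive R (s≤s z≤n)) (≤-reflexive (boundary-start R))
    (subst (_< boundary R 1) (boundary-start R) (boundary-step R 0 (runs-positive R (s≤s z≤n))))

  prependRun : ∀ {m n} (P : Fin (suc n) → ℕ) → P F.zero < m →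
    (R : RunDecomposition m n (λ l → P (F.suc l))) → (0 < runs R → P F.zero < value R 0) →
    RunDecomposition m (suc n) P
  prependRun {m} {n} P P0<m R P0<value = record
    { runs = suc (runs R) ; boundary = boundary′ ; value = value′
    ; boundary-start = refl ; boundary-end = cong suc (boundary-end R)
    ; boundary-step = boundary-step′ ; value-step = value-step′
    ; value-bound = value-bound′ ; constant = constant′ }
    where
    boundary′ value′ : ℕ → ℕ
    boundary′ zero    = 0
    boundary′ (suc j) = suc (boundary R j)
    value′ zero    = P F.zero
    value′ (suc j) = value R j
    boundary-step′ : ∀ j → j < suc (runs R) → boundary′ j < boundary′ (suc j)
    boundary-step′ zero    _         = s≤s z≤n
    boundary-step′ (suc j) (s≤s j<r) = s≤s (boundary-step R j j<r)
    value-step′ : ∀ j → suc j < suc (runs R) → value′ j < value′ (suc j)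
    value-step′ zero    (s≤s 0<r)   = P0<value 0<r
    value-step′ (suc j) (s≤s j+1<r) = value-step R j j+1<r
    value-bound′ : ∀ j → j < suc (runs R) → value′ j < m
    value-bound′ zero    _         = P0<m
    value-bound′ (suc j) (s≤s j<r) = value-bound R j j<r
    constant′ : ∀ (l : Fin (suc n)) j → j < suc (runs R) →
                boundary′ j ≤ toℕ l → toℕ l < boundary′ (suc j) → P l ≡ value′ j
    constant′ F.zero    zero    _         _         _         = refl
    constant′ (F.suc l) zero    _         _         (s≤s l<b) with ≤-trans l<b (≤-reflexive (boundary-start R))
    ... | ()
    constant′ (F.suc l) (suc j) (s≤s j<r) (s≤s b≤l) (s≤s l<b) = constant R l j j<r b≤l l<b

  extendFirstRun : ∀ {m n} (P : Fin (suc n) → ℕ) (R : RunDecomposition m n (λ l → P (F.suc l))) →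
    0 < runs R → P F.zero ≡ value R 0 → RunDecomposition m (suc n) P
  extendFirstRun {m} {n} P R 0<r P0≡value = record
    { runs = runs R ; boundary = boundary′ ; value = value R
    ; boundary-start = refl ; boundary-end = boundary-end′
    ; boundary-step = boundary-step′ ; value-step = value-step R
    ; value-bound = value-bound R ; constant = constant′ }
    where
    boundary′ : ℕ → ℕ
    boundary′ zero    = 0
    boundary′ (suc j) = suc (boundary R (suc j))
    boundary′-shift : ∀ j → 0 < j → boundary′ j ≡ suc (boundary R j)
    boundary′-shift (suc j) _ = refl
    boundary-end′ : boundary′ (runs R) ≡ suc n
    boundary-end′ = trans (boundary′-shift (runs R) 0<r) (cong suc (boundary-end R))
    boundary-step′ : ∀ j → j < runs R → boundary′ j < boundary′ (suc j)
    boundary-step′ zero    _       = s≤s z≤n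
    boundary-step′ (suc j) j+1<r = s≤s (boundary-step R (suc j) j+1<r)
    constant′ : ∀ (l : Fin (suc n)) j → j < runs R →
                boundary′ j ≤ toℕ l → toℕ l < boundary′ (suc j) → P l ≡ value R j
    constant′ F.zero    zero    _   _         _         = P0≡value
    constant′ (F.suc l) zero    j<r _         (s≤s l<b) =
      constant R l zero j<r (≤-trans (≤-reflexive (boundary-start R)) z≤n) l<b
    constant′ (F.suc l) (suc j) j<r (s≤s b≤l) (s≤s l<b) = constant R l (suc j) j<r b≤l l<b

  runDecomposition : ∀ m n (P : Fin n → ℕ) → (∀ i j → toℕ i ≤ toℕ j → P i ≤ P j) →
                     (∀ l → P l < m) → RunDecomposition m n P
  runDecomposition m zero P mono bound = record
    { runs = 0 ; boundary = λ _ → 0 ; value = λ _ → 0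
    ; boundary-start = refl ; boundary-end = refl
    ; boundary-step = λ _ () ; value-step = λ _ () ; value-bound = λ _ () ; constant = λ () }
  runDecomposition m (suc n) P mono bound
    with runDecomposition m n (λ l → P (F.suc l))
           (λ i j i≤j → mono (F.suc i) (F.suc j) (s≤s i≤j)) (λ l → bound (F.suc l))
  runDecomposition m (suc zero) P mono bound | R =
    prependRun P (bound F.zero) R (λ 0<r → ⊥-elim (n≮n 0 (<-≤-trans 0<r (runs≤length R))))
  runDecomposition m (suc (suc n)) P mono bound | R
    with m≤n⇒m<n∨m≡n (mono F.zero (F.suc F.zero) z≤n)
  ... | inj₁ P0<P1 = prependRun P (bound F.zero) R (λ _ → subst (P F.zero <_) (value-first R) P0<P1)
  ... | inj₂ P0≡P1 = extendFirstRun P R (runs-positive R (s≤s z≤n)) (trans P0≡P1 (value-first R))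

open RunConstruction using (runDecomposition)

module Partition (k : ℕ) (ℓ : Fin (suc k) → ℕ) (ℓ-strict : ∀ i j → toℕ i < toℕ j → ℓ i < ℓ j) where

  InBlock : ℕ → Fin k → Set
  InBlock l j = ℓ (inject₁ j) ≤ l × l < ℓ (F.suc j)

  block-nonempty : ∀ j → ℓ (inject₁ j) < ℓ (F.suc j)
  block-nonempty j = ℓ-strict (inject₁ j) (F.suc j) (subst (_< suc (toℕ j)) (sym (toℕ-inject₁ j)) (n<1+n _))

  block-end≤last : ∀ j → ℓ (F.suc j) ≤ ℓ (fromℕ k)
  block-end≤last j = strict⇒weak ℓ ℓ-strict (F.suc j) (fromℕ k)
                       (subst (suc (toℕ j) ≤_) (sym (toℕ-fromℕ k)) (toℕ<n j))

  blockOf : ∀ l → ℓ F.zero ≤ l → l < ℓ (fromℕ k) → Σ (Fin k) (InBlock l)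
  blockOf = search k ℓ
    where
    search : ∀ k (ℓ : Fin (suc k) → ℕ) l → ℓ F.zero ≤ l → l < ℓ (fromℕ k) →
             Σ (Fin k) λ j → ℓ (inject₁ j) ≤ l × l < ℓ (F.suc j)
    search zero    ℓ l ℓ0≤l l<ℓk = ⊥-elim (n≮n l (<-≤-trans l<ℓk ℓ0≤l))
    search (suc k) ℓ l ℓ0≤l l<ℓk with l <? ℓ (inject₁ (fromℕ k))
    ... | yes l<ℓ = let (j , in-j) = search k (λ i → ℓ (inject₁ i)) l ℓ0≤l l<ℓ in inject₁ j , in-j
    ... | no l≮ℓ  = fromℕ k , ≮⇒≥ l≮ℓ , l<ℓk

  blocks-ordered : ∀ {l l′ j j′} → InBlock l j → InBlock l′ j′ → l ≤ l′ → toℕ j ≤ toℕ j′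
  blocks-ordered {l} {l′} {j} {j′} (ℓj≤l , _) (_ , l′<ℓj′) l≤l′ with toℕ j ≤? toℕ j′
  ... | yes j≤j′ = j≤j′
  ... | no  j≰j′ = ⊥-elim (n≮n l′ (<-≤-trans l′<ℓj′ (≤-trans ℓj′≤ℓj (≤-trans ℓj≤l l≤l′))))
    where
    ℓj′≤ℓj : ℓ (F.suc j′) ≤ ℓ (inject₁ j)
    ℓj′≤ℓj = strict⇒weak ℓ ℓ-strict (F.suc j′) (inject₁ j)
               (subst (suc (toℕ j′) ≤_) (sym (toℕ-inject₁ j)) (≰⇒> j≰j′))

module Characterisation {a r : Level} {X : Set a} (_≼_ : Rel X r)
  (≼-trans : ∀ {x y z} → x ≼ y → y ≼ z → x ≼ z)
  (u : List X) (B : ℕ → ℕ → List X) (basis : BasisChoice _≼_ u B) (w : List X) where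

  n m : ℕ
  n = length u
  m = length w

  module FromStuttering (u-nonempty : 0 < n) (p : Fin n → Fin m)
                        (p-mono : ∀ i j → toℕ i ≤ toℕ j → toℕ (p i) ≤ toℕ (p j))
                        (p-above : ∀ l → lookup u l ≼ lookup w (p l)) where

    R : RunDecomposition m n (λ l → toℕ (p l))
    R = runDecomposition m n (λ l → toℕ (p l)) p-mono (λ l → toℕ<n (p l))

    open RunDecomposition R

    image : ∀ j → j < runs → Fin m
    image j j<r = fromℕ< (value-bound j j<r)

    image-above-run : ∀ j (j<r : j < runs) →
                      Inter _≼_ u (boundary j) (boundary (suc j)) (lookup w (image j j<r))
    image-above-run j j<r l b≤l l<b = subst (λ t → lookup u l ≼ lookup w t)
      (toℕ-injective (trans (constant l j j<r b≤l l<b) (sym (toℕ-fromℕ< (value-bound j j<r))))) (p-above l)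

    basisBelow : ∀ j (j<r : j < runs) → UpX _≼_ (B (boundary j) (boundary (suc j))) (lookup w (image j j<r))
    basisBelow j j<r = Equivalence.to (proj₂ run-basis (lookup w (image j j<r))) (image-above-run j j<r)
      where
      run-basis : IsFiniteBasis _≼_ (Inter _≼_ u (boundary j) (boundary (suc j))) (B (boundary j) (boundary (suc j)))
      run-basis = basis (boundary j) (boundary (suc j)) (boundary-step j j<r) (boundary≤length (suc j) j<r)

    ys : List X
    ys = tabulate< runs (λ j j<r → proj₁ (basisBelow j j<r))

    length-ys : length ys ≡ runs
    length-ys = length-tabulate< runs _

    lookup-ys : ∀ (j : Fin (length ys)) →
                Σ (toℕ j < runs) λ j<r → lookup ys j ≡ proj₁ (basisBelow (toℕ j) j<r)
    lookup-ys = lookup-tabulate< runs _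

    ys-generator : Gen _≼_ u B ys
    ys-generator =
        subst (0 <_) (sym length-ys) (runs-positive u-nonempty)
      , subst (_≤ n) (sym length-ys) runs≤length
      , (λ i → boundary (toℕ i)) , boundary-start
      , trans (cong boundary (trans (toℕ-fromℕ (length ys)) length-ys)) boundary-end
      , (λ i j i<j → boundary-strict (toℕ i) (toℕ j) i<j
                       (subst (toℕ j ≤_) length-ys (≤-pred (toℕ<n j))))
      , ys-in-basis
      where
      ys-in-basis : ∀ (j : Fin (length ys)) →
                    lookup ys j ∈ B (boundary (toℕ (inject₁ j))) (boundary (suc (toℕ j)))
      ys-in-basis j with lookup-ys j
      ... | j<r , eq rewrite eq | toℕ-inject₁ j = proj₁ (proj₂ (basisBelow (toℕ j) j<r))

    ys-embeds : HigmanLe _≼_ ys w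
    ys-embeds = q , q-strict , q-above
      where
      q : Fin (length ys) → Fin m
      q j = image (toℕ j) (proj₁ (lookup-ys j))
      q-strict : ∀ i j → toℕ i < toℕ j → toℕ (q i) < toℕ (q j)
      q-strict i j i<j
        rewrite toℕ-fromℕ< (value-bound (toℕ i) (proj₁ (lookup-ys i)))
              | toℕ-fromℕ< (value-bound (toℕ j) (proj₁ (lookup-ys j))) =
        value-strict (toℕ i) (toℕ j) i<j (proj₁ (lookup-ys j))
      q-above : ∀ j → lookup ys j ≼ lookup w (q j)
      q-above j = subst (_≼ lookup w (q j)) (sym (proj₂ (lookup-ys j)))
                        (proj₂ (proj₂ (basisBelow (toℕ j) (proj₁ (lookup-ys j)))))

  stuttering⇒generated : 0 < n → StutterLe _≼_ u w → UpHigman _≼_ (Gen _≼_ u B) w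
  stuttering⇒generated u-nonempty (p , p-mono , p-above) = ys , ys-generator , ys-embeds
    where open FromStuttering u-nonempty p p-mono p-above

  generated⇒stuttering : UpHigman _≼_ (Gen _≼_ u B) w → StutterLe _≼_ u w
  generated⇒stuttering
    (ys , (_ , _ , ℓ , ℓ-start , ℓ-end , ℓ-strict , ys-in-basis) , (q , q-strict , q-above)) =
    p , p-mono , p-above
    where
    open Partition (length ys) ℓ ℓ-strict
    block : (l : Fin n) → Σ (Fin (length ys)) (InBlock (toℕ l))
    block l = blockOf (toℕ l) (≤-trans (≤-reflexive ℓ-start) z≤n)
                      (subst (toℕ l <_) (sym ℓ-end) (toℕ<n l))
    p : Fin n → Fin m
    p l = q (proj₁ (block l))
    p-mono : ∀ i j → toℕ i ≤ toℕ j → toℕ (p i) ≤ toℕ (p j)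
    p-mono i j i≤j = strict⇒weak (λ t → toℕ (q t)) q-strict (proj₁ (block i)) (proj₁ (block j))
                       (blocks-ordered (proj₂ (block i)) (proj₂ (block j)) i≤j)
    block-basis : ∀ j → IsFiniteBasis _≼_ (Inter _≼_ u (ℓ (inject₁ j)) (ℓ (F.suc j))) (B (ℓ (inject₁ j)) (ℓ (F.suc j)))
    block-basis j = basis _ _ (block-nonempty j) (≤-trans (block-end≤last j) (≤-reflexive ℓ-end))
    p-above : ∀ l → lookup u l ≼ lookup w (p l)
    p-above l with block l
    ... | j , ℓj≤l , l<ℓj+1 = ≼-trans (proj₁ (block-basis j) (ys-in-basis j) l ℓj≤l l<ℓj+1) (q-above j)

empty-stutter⇔higman : ∀ {a r} {X : Set a} (_≼_ : Rel X r) (w : List X) →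
                       StutterLe _≼_ [] w ⇔ HigmanLe _≼_ [] w
empty-stutter⇔higman _≼_ w =
  mk⇔ (λ (p , _ , above) → p , (λ ()) , above) (λ (p , _ , above) → p , (λ ()) , above)

mainTheorem11 : ∀ {a r : Level} {X : Set a} (_≼_ : Rel X r) → IsWQO _≼_ →
    ((u : List X) → 0 < length u → (B : ℕ → ℕ → List X) → BasisChoice _≼_ u B →
      ∀ (w : List X) → StutterLe _≼_ u w ⇔ UpHigman _≼_ (Gen _≼_ u B) w)
    × (∀ (w : List X) → StutterLe _≼_ [] w ⇔ HigmanLe _≼_ [] w)
mainTheorem11 _≼_ (_ , ≼-trans , _) =
    (λ u u-nonempty B basis w → let open Characterisation _≼_ ≼-trans u B basis w in
       mk⇔ (stuttering⇒generated u-nonempty) generated⇒stuttering)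
  , empty-stutter⇔higman _≼_
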